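{- Let $l,r$ be terms, $L[t]$ a literal, $C$, $D$, $D'$ clauses and $\sigma$ a substitution such that $D = C\sigma \lor D'$ (as multisets of literals, $D$ is the multiset union of $C\sigma$ and $D'$). Then the following two conditions are equivalent: (R1) $L[t] \lor D \succ (l {\,\simeq\,} r)\sigma \lor C\sigma$; (R2) $L[t] \lor D' \succ (l {\,\simeq\,} r)\sigma$.
   Context: Clauses are finite multisets of literals, read as disjunctions; $A \lor B$ for clauses denotes multiset union. $E\sigma$ denotes the result of applying substitution $\sigma$, and $L[t]$ denotes a literal with a particular occurrence of the term $t$. The symbol $\succ$ is a fixed simplification ordering on terms (a well-founded strict partial order stable under substitutions, monotonic, with the subterm property), extended to a strict ordering on literals, and extended to clauses as the multiset extension of the literal ordering. -}

module Defs where

open import Level using (0ℓ)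
import Data.Empty
import Data.Unit
import Data.Sum
open import Data.Bool using (Bool)
open import Data.List using (List; []; _∷_; _++_; map)
open import Data.List.Relation.Unary.Any using (Any)
open import Data.List.Relation.Unary.All using (All)
open import Data.List.Membership.Propositional using (_∈_)
open import Data.List.Relation.Binary.Permutation.Propositional using (_↭_)
open import Data.Product using (Σ; ∃; _×_; _,_)
open import Relation.Binary.Core using (Rel)
open import Relation.Binary.PropositionalEquality using (_≡_)
open import Induction.WellFounded using (WellFounded)

data Term (F V : Set) : Set where
  var : V → Term F V
  fun : F → List (Term F V) → Term F V

Subst : Set → Set → Set
Subst F V = V → Term F V

mutual
  _·_ : {F V : Set} → Term F V → Subst F V → Term F V
  var x · σ = σ x
  fun f ts · σ = fun f (ts ·* σ)

  _·*_ : {F V : Set} → List (Term F V) → Subst F V → List (Term F V)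
  [] ·* σ = []
  (t ∷ ts) ·* σ = (t · σ) ∷ (ts ·* σ)

data _⊴_ {F V : Set} (s : Term F V) : Term F V → Set where
  here : s ⊴ s
  arg  : ∀ {f ts u} → u ∈ ts → s ⊴ u → s ⊴ fun f ts

record IsSimplificationOrdering {F V : Set} (_≻_ : Rel (Term F V) 0ℓ) : Set where
  field
    irrefl      : ∀ {s} → s ≻ s → Data.Empty.⊥
    trans       : ∀ {s t u} → s ≻ t → t ≻ u → s ≻ u
    wf          : WellFounded (λ s t → t ≻ s)
    stable      : ∀ {s t} (σ : Subst F V) → s ≻ t → (s · σ) ≻ (t · σ)
    monotonic   : ∀ {s t} f (xs ys : List (Term F V)) → s ≻ t →
                  fun f (xs ++ s ∷ ys) ≻ fun f (xs ++ t ∷ ys)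
    subterm     : ∀ f (xs ys : List (Term F V)) (s : Term F V) →
                  fun f (xs ++ s ∷ ys) ≻ s

record Literal (F V : Set) : Set where
  constructor lit
  field
    positive : Bool
    lhs rhs  : Term F V

_≃_ : {F V : Set} → Term F V → Term F V → Literal F V
s ≃ t = lit Bool.true s t
  where import Data.Bool as Bool

_·L_ : {F V : Set} → Literal F V → Subst F V → Literal F V
lit p s t ·L σ = lit p (s · σ) (t · σ)

_occursIn_ : {F V : Set} → Term F V → Literal F V → Set
t occursIn lit p s u = (t ⊴ s) Data.Sum.⊎ (t ⊴ u)

-- Clauses: finite multisets of literals, represented by lists considered
-- up to permutation (_↭_); A ∨ B is list concatenation (multiset union).
Clause : Set → Set → Set
Clause F V = List (Literal F V)

_·C_ : {F V : Set} → Clause F V → Subst F V → Clause F V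
C ·C σ = map (_·L σ) C

-- Dershowitz–Manna multiset extension of a strict order:
-- M ≻ N iff M = Z + X, N = Z + Y (as multisets), X ≠ ∅ and every
-- element of Y is dominated by some element of X.

NonEmpty : {A : Set} → List A → Set
NonEmpty [] = Data.Empty.⊥
NonEmpty (_ ∷ _) = Data.Unit.⊤

MulExt : {A : Set} → Rel A 0ℓ → Rel (List A) 0ℓ
MulExt {A} _≻_ M N =
  Σ (List A) λ Z → Σ (List A) λ X → Σ (List A) λ Y →
    (M ↭ Z ++ X) × (N ↭ Z ++ Y) × NonEmpty X ×
    All (λ y → Any (λ x → x ≻ y) X) Y

-- For a strict partial order the multiset extension is cancellative: M + K ≻ N + K iff M ≻ N.
-- Adding K is immediate (enlarge the common part Z).  To cancel one common element c: if c lies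
-- in Z, drop it from Z; otherwise c lies in both X and Y, and the element of X dominating the c
-- of Y is not c itself (irreflexivity), so by transitivity it takes over everything c dominated
-- in Y, and c can be dropped from both.  The theorem is this cancellation with K = Cσ; neither
-- the term ordering nor the occurrence of t in L plays any role.
module Submission where

open import Defs
open import Level using (0ℓ)
open import Data.List using (List; _∷_; []; _++_)
open import Data.List.Relation.Unary.Any as Any using (Any; here; there)
open import Data.List.Relation.Unary.All as All using (All; _∷_)
open import Data.List.Membership.Propositional using (_∈_)
open import Data.List.Membership.Propositional.Properties using (∈-∃++; ∈-++⁻)
open import Data.List.Relation.Binary.Permutation.Propositional
  using (_↭_; ↭-sym; ↭-trans; prep; module PermutationReasoning)
open import Data.List.Relation.Binary.Permutation.Propositional.Properties
  using (shift; drop-∷; ++⁺ˡ; ++⁺ʳ; ++-assoc; ++-comm; ∈-resp-↭; Any-resp-↭; All-resp-↭)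
open import Data.Product using (∃; _,_)
open import Data.Sum using (inj₁; inj₂)
open import Data.Empty using (⊥-elim)
open import Data.Unit using (tt)
open import Relation.Binary.Core using (Rel)
open import Relation.Binary.PropositionalEquality using (_≡_; refl)
open import Relation.Binary.Structures using (IsStrictPartialOrder)
open import Function.Bundles using (_⇔_; mk⇔; module Equivalence)

∈⇒↭∷ : {A : Set} {x : A} {xs : List A} → x ∈ xs → ∃ λ ys → xs ↭ x ∷ ys
∈⇒↭∷ {x = x} x∈xs with ys , zs , refl ← ∈-∃++ x∈xs = ys ++ zs , shift x ys zs

Any⇒NonEmpty : {A : Set} {P : A → Set} {xs : List A} → Any P xs → NonEmpty xs
Any⇒NonEmpty (here _)  = tt
Any⇒NonEmpty (there _) = tt

module _ {A : Set} (_≻_ : Rel A 0ℓ) where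

  MulExt-resp-↭ : {M M′ N N′ : List A} → M ↭ M′ → N ↭ N′ →
                  MulExt _≻_ M N → MulExt _≻_ M′ N′
  MulExt-resp-↭ M↭M′ N↭N′ (Z , X , Y , M↭ , N↭ , X≢[] , X≻Y) =
    Z , X , Y , ↭-trans (↭-sym M↭M′) M↭ , ↭-trans (↭-sym N↭N′) N↭ , X≢[] , X≻Y

  MulExt-++⁺ˡ : (K : List A) {M N : List A} →
                MulExt _≻_ M N → MulExt _≻_ (K ++ M) (K ++ N)
  MulExt-++⁺ˡ K (Z , X , Y , M↭ , N↭ , X≢[] , X≻Y) =
    K ++ Z , X , Y ,
    ↭-trans (++⁺ˡ K M↭) (↭-sym (++-assoc K Z X)) ,
    ↭-trans (++⁺ˡ K N↭) (↭-sym (++-assoc K Z Y)) ,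
    X≢[] , X≻Y

module _ {A : Set} {_≻_ : Rel A 0ℓ} (spo : IsStrictPartialOrder _≡_ _≻_) where
  open IsStrictPartialOrder spo using (irrefl; trans)
  open PermutationReasoning

  private
    ↭-drop-from-++ˡ : {c : A} {M Z Z′ X : List A} →
                      Z ↭ c ∷ Z′ → c ∷ M ↭ Z ++ X → M ↭ Z′ ++ X
    ↭-drop-from-++ˡ {c} {M} {Z} {Z′} {X} Z↭ M↭ = drop-∷ (begin
      c ∷ M        ↭⟨ M↭ ⟩
      Z ++ X       ↭⟨ ++⁺ʳ X Z↭ ⟩
      c ∷ Z′ ++ X  ∎)

    ↭-drop-from-++ʳ : {c : A} {M Z X X′ : List A} →
                      X ↭ c ∷ X′ → c ∷ M ↭ Z ++ X → M ↭ Z ++ X′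
    ↭-drop-from-++ʳ {c} {M} {Z} {X} {X′} X↭ M↭ = drop-∷ (begin
      c ∷ M         ↭⟨ M↭ ⟩
      Z ++ X        ↭⟨ ++⁺ˡ Z X↭ ⟩
      Z ++ c ∷ X′   ↭⟨ shift c Z X′ ⟩
      c ∷ Z ++ X′   ∎)

    dominated-via : {c y : A} {X : List A} →
                    Any (_≻ c) X → Any (_≻ y) (c ∷ X) → Any (_≻ y) X
    dominated-via X≻c (here c≻y)  = Any.map (λ x≻c → trans x≻c c≻y) X≻c
    dominated-via X≻c (there X≻y) = X≻y

    drop-from-common : {c : A} {M N Z X Y : List A} → c ∈ Z →
                       c ∷ M ↭ Z ++ X → c ∷ N ↭ Z ++ Y → NonEmpty X →
                       All (λ y → Any (_≻ y) X) Y → MulExt _≻_ M N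
    drop-from-common {X = X} {Y} c∈Z M↭ N↭ X≢[] X≻Y with Z′ , Z↭ ← ∈⇒↭∷ c∈Z =
      Z′ , X , Y , ↭-drop-from-++ˡ Z↭ M↭ , ↭-drop-from-++ˡ Z↭ N↭ , X≢[] , X≻Y

  MulExt-∷⁻ : (c : A) {M N : List A} →
              MulExt _≻_ (c ∷ M) (c ∷ N) → MulExt _≻_ M N
  MulExt-∷⁻ c {M} {N} (Z , X , Y , M↭ , N↭ , X≢[] , X≻Y)
    with ∈-++⁻ Z (∈-resp-↭ M↭ (here refl)) | ∈-++⁻ Z (∈-resp-↭ N↭ (here refl))
  ... | inj₁ c∈Z | _       = drop-from-common c∈Z M↭ N↭ X≢[] X≻Y
  ... | inj₂ _   | inj₁ c∈Z = drop-from-common c∈Z M↭ N↭ X≢[] X≻Y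
  ... | inj₂ c∈X | inj₂ c∈Y
    with X′ , X↭ ← ∈⇒↭∷ c∈X | Y′ , Y↭ ← ∈⇒↭∷ c∈Y
    with X≻c ∷ X≻Y′ ← All-resp-↭ Y↭ X≻Y
    with Any-resp-↭ X↭ X≻c
  ... | here c≻c = ⊥-elim (irrefl refl c≻c)
  ... | there X′≻c =
    Z , X′ , Y′ , ↭-drop-from-++ʳ X↭ M↭ , ↭-drop-from-++ʳ Y↭ N↭ , Any⇒NonEmpty X′≻c ,
    All.map (λ X≻y → dominated-via X′≻c (Any-resp-↭ X↭ X≻y)) X≻Y′

  MulExt-++⁻ˡ : (K : List A) {M N : List A} →
                MulExt _≻_ (K ++ M) (K ++ N) → MulExt _≻_ M N
  MulExt-++⁻ˡ []      KM≻KN = KM≻KN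
  MulExt-++⁻ˡ (k ∷ K) KM≻KN = MulExt-++⁻ˡ K (MulExt-∷⁻ k KM≻KN)

  MulExt-++ˡ-cancel : (K : List A) {M N : List A} →
                      MulExt _≻_ (K ++ M) (K ++ N) ⇔ MulExt _≻_ M N
  MulExt-++ˡ-cancel K = mk⇔ (MulExt-++⁻ˡ K) (MulExt-++⁺ˡ _≻_ K)

theorem3 : {F V : Set}
    (_≻t_ : Rel (Term F V) 0ℓ) → IsSimplificationOrdering _≻t_ →
    (_≻L_ : Rel (Literal F V) 0ℓ) → IsStrictPartialOrder _≡_ _≻L_ →
    (l r t : Term F V) (L : Literal F V) → t occursIn L →
    (C D D′ : Clause F V) (σ : Subst F V) →
    D ↭ (C ·C σ) ++ D′ →
    MulExt _≻L_ (L ∷ D) (((l ≃ r) ·L σ) ∷ (C ·C σ))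
    ⇔ MulExt _≻L_ (L ∷ D′) (((l ≃ r) ·L σ) ∷ [])
theorem3 {F} {V} _ _ _≻L_ spo l r _ L _ C D D′ σ D↭ = mk⇔
  (λ R1 → Equivalence.to   (MulExt-++ˡ-cancel spo Cσ) (MulExt-resp-↭ _≻L_ L∷D↭ lr∷Cσ↭ R1))
  (λ R2 → MulExt-resp-↭ _≻L_ (↭-sym L∷D↭) (↭-sym lr∷Cσ↭)
            (Equivalence.from (MulExt-++ˡ-cancel spo Cσ) R2))
  where
  Cσ : Clause F V
  Cσ = C ·C σ
  L∷D↭ : L ∷ D ↭ Cσ ++ L ∷ D′
  L∷D↭ = ↭-trans (prep L D↭) (↭-sym (shift L Cσ D′))
  lr∷Cσ↭ : ((l ≃ r) ·L σ) ∷ Cσ ↭ Cσ ++ ((l ≃ r) ·L σ) ∷ []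
  lr∷Cσ↭ = ++-comm (((l ≃ r) ·L σ) ∷ []) Cσ
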